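{- Let $r>k\ge 2$. For each $n\ge 1$ let $G_n$ be a graph on $n$ vertices such that (1) $G_n$ has $n^k e^{ -O(\sqrt{\log n})}$ subgraphs isomorphic to $K_r$, and (2) every copy of $K_k$ in $G_n$ is contained in exactly one maximal clique, and this clique has size at most $r$. Let $H_n$ be the $r$-graph on $V(G_n)$ whose edges are the vertex sets of copies of $K_r$ in $G_n$. Then: (i) $e(H_n)\ge n^k e^{ -O(\sqrt{\log n})}$; (ii) any two distinct edges of $H_n$ intersect in at most $k-1$ vertices; (iii) $H_n$ contains no subgraph isomorphic to $\mathrm{E}^r(K^k_{k+1})$.
   Context: $K_r$ denotes the complete graph on $r$ vertices and $K_{k+1}^k$ the complete $k$-uniform hypergraph on $k+1$ vertices. For a $k$-graph $F$ and $r\ge k$, the expansion $\mathrm{E}^r(F)$ is the $r$-uniform hypergraph obtained by enlarging each edge of $F$ with a set of $r-k$ new vertices of degree one. The constants implicit in $O(\cdot)$ depend only on $r,k$. -}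

module Defs where

open import Data.Nat using (ℕ; zero; suc; _+_; _*_; _∸_; _^_; _≤_; _≤?_)
open import Data.Nat.Logarithm using (⌊log₂_⌋)
open import Data.Bool using (Bool; true; false; if_then_else_)
open import Data.Fin using (Fin)
open import Data.Fin.Properties using (all?)
open import Data.Fin.Subset using (Subset; _∈_; _⊆_; _⊂_; ∣_∣)
open import Data.Fin.Subset.Properties using (_∈?_)
open import Data.List using (List; []; _∷_; _++_; map; filter; length)
open import Data.Vec using ([]; _∷_)
open import Data.Product using (Σ; _×_; _,_; ∃)
open import Data.Sum using (_⊎_)
open import Relation.Nullary using (¬_; Dec; yes; no)
open import Relation.Nullary.Decidable using (_×-dec_; _→-dec_; ¬?)
open import Relation.Binary.PropositionalEquality using (_≡_; _≢_)
open import Data.Nat.Properties using (_≟_)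
import Data.Fin.Properties as FinP
open import Data.Bool.Properties using () renaming (_≟_ to _≟ᵇ_)
open import Function.Definitions using (Injective)

record Graph (n : ℕ) : Set where
  field
    adj     : Fin n → Fin n → Bool
    symm    : ∀ i j → adj i j ≡ adj j i
    irrefl  : ∀ i → adj i i ≡ false
open Graph public

IsClique : ∀ {n} → Graph n → Subset n → Set
IsClique {n} G S = ∀ (i j : Fin n) → i ∈ S → j ∈ S → i ≢ j → adj G i j ≡ true

IsMaximalClique : ∀ {n} → Graph n → Subset n → Set
IsMaximalClique G S = IsClique G S × (∀ T → IsClique G T → ¬ (S ⊂ T))

-- Vertex sets of copies of K_r in G (a copy of K_r is determined by its vertex set).
IsKrSet : ∀ {n} → Graph n → ℕ → Subset n → Set
IsKrSet G r S = IsClique G S × ∣ S ∣ ≡ r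

isClique? : ∀ {n} (G : Graph n) (S : Subset n) → Dec (IsClique G S)
isClique? G S =
  all? λ i → all? λ j → (i ∈? S) →-dec ((j ∈? S) →-dec
    ((¬? (i FinP.≟ j)) →-dec (adj G i j ≟ᵇ true)))

isKrSet? : ∀ {n} (G : Graph n) (r : ℕ) (S : Subset n) → Dec (IsKrSet G r S)
isKrSet? G r S = isClique? G S ×-dec (∣ S ∣ ≟ r)

allSubsets : ∀ n → List (Subset n)
allSubsets zero    = [] ∷ []
allSubsets (suc n) = map (true ∷_) (allSubsets n) ++ map (false ∷_) (allSubsets n)

#Kr : ∀ {n} → Graph n → ℕ → ℕ
#Kr {n} G r = length (filter (isKrSet? G r) (allSubsets n))

IsEdgeH : ∀ {n} → Graph n → ℕ → Subset n → Set
IsEdgeH = IsKrSet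

eH : ∀ {n} → Graph n → ℕ → ℕ
eH = #Kr

-- Vertices of E^r(K^k_{k+1}): core vertices Fin (suc k), and for each edge of
-- K^k_{k+1} (the k-set missing core vertex i) r ∸ k new vertices (i , t).
-- A copy is an injective vertex map φ such that, for each i, the image of the
-- i-th expanded edge  {φ(core j) | j ≠ i} ∪ {φ(new i t) | t}  is an edge of H.

ExpVertex : ℕ → ℕ → Set
ExpVertex r k = Fin (suc k) ⊎ (Fin (suc k) × Fin (r ∸ k))

ExpEdge : (r k : ℕ) → Fin (suc k) → ExpVertex r k → Set
ExpEdge r k i (Data.Sum.inj₁ j)       = j ≢ i
ExpEdge r k i (Data.Sum.inj₂ (i' , t)) = i' ≡ i

HasExpansionCopy : ∀ {n} → Graph n → (r k : ℕ) → Set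
HasExpansionCopy {n} G r k =
  Σ (ExpVertex r k → Fin n) λ φ →
    Injective _≡_ _≡_ φ ×
    (∀ (i : Fin (suc k)) → Σ (Subset n) λ S →
        IsEdgeH G r S ×
        (∀ (v : Fin n) → (v ∈ S → ∃ λ x → ExpEdge r k i x × φ x ≡ v)
                       × (∀ x → ExpEdge r k i x → φ x ∈ S)))

-- Asymptotics: f(n) ≥ n^k e^{-O(√log n)}, expressed over ℕ:
-- there are constants C, N with  n^k ≤ f(n) · 2^(C · (⌊√⌊log₂ n⌋⌋ + 1))  for all n ≥ N.

isqrt : ℕ → ℕ
isqrt zero = zero
isqrt (suc n) with suc (isqrt n) * suc (isqrt n) ≤? suc n
... | yes _ = suc (isqrt n)
... | no  _ = isqrt n

AtLeastPolyExpSqrtLog : (k : ℕ) → (ℕ → ℕ) → Set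
AtLeastPolyExpSqrtLog k f =
  Σ ℕ λ C → Σ ℕ λ N → ∀ n → N ≤ n →
    n ^ k ≤ f n * 2 ^ (C * (isqrt ⌊log₂ n ⌋ + 1))

-- Every clique extends to a maximal clique; if it contains a copy of K_k, that maximal
-- clique is the unique one M over this K_k, and ∣ M ∣ ≤ r forces every K_r through the
-- K_k to equal M. So two edges of H sharing k vertices coincide. In a copy of
-- E^r(K^k_{k+1}) the k + 1 core vertices form a clique, because any two of them avoid a
-- third core and so lie in a common edge (here k ≥ 2 is used); the edge missing core 0
-- is then the maximal clique over the other k cores, hence contains core 0 as well.
module Submission where

open import Defs
open import Data.Nat using (ℕ; suc; _≤_; _<_; _∸_)
open import Data.Fin.Subset using (Subset; _⊆_; _∩_; ∣_∣)
open import Data.Product using (Σ; _×_)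
open import Relation.Nullary using (¬_)
open import Relation.Binary.PropositionalEquality using (_≡_; _≢_)

open import Data.Nat using (zero; z≤n; s≤s; _+_; _<?_)
open import Data.Nat.Properties
  using (≤-trans; ≤-reflexive; ≤-pred; <-≤-trans; <⇒≱; ≮⇒≥; m≤m+n; +-suc; +-monoʳ-≤)
open import Data.Fin using (Fin; zero; suc)
open import Data.Fin.Subset using (_∈_; _∉_; ⊥; ⁅_⁆; _∪_; _-_; outside; inside)
open import Data.Fin.Subset.Properties
open import Data.Vec using (_∷_)
open import Data.Product using (_,_; proj₁; proj₂; ∃)
open import Data.Sum using (inj₁; inj₂)
open import Data.Empty using (⊥-elim)
open import Relation.Nullary using (yes; no; contradiction)
open import Relation.Nullary.Decidable using (_×-dec_)
open import Relation.Binary.PropositionalEquality using (refl; sym; trans; cong; subst)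
open import Function using (_∘_)
open import Function.Definitions using (Injective)
open import Data.Fin.Properties using (suc-injective; 0≢1+n)

p⊆q∧∣q∣≤∣p∣⇒p≡q : ∀ {n} {p q : Subset n} → p ⊆ q → ∣ q ∣ ≤ ∣ p ∣ → p ≡ q
p⊆q∧∣q∣≤∣p∣⇒p≡q {p = p} {q} p⊆q ∣q∣≤∣p∣ = ⊆-antisym p⊆q q⊆p
  where
  q⊆p : q ⊆ p
  q⊆p {x} x∈q with x ∈? p
  ... | yes x∈p = x∈p
  ... | no  x∉p = contradiction ∣q∣≤∣p∣ (<⇒≱ (p⊂q⇒∣p∣<∣q∣ (p⊆q , x , x∈q , x∉p)))

⊆-ofSize : ∀ {n} m (X : Subset n) → m ≤ ∣ X ∣ → ∃ λ Y → Y ⊆ X × ∣ Y ∣ ≡ m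
⊆-ofSize {n} zero    X             _     = ⊥ , (λ x∈⊥ → ⊥-elim (∉⊥ x∈⊥)) , ∣⊥∣≡0 n
⊆-ofSize (suc m) (outside ∷ X) 1+m≤∣X∣ with ⊆-ofSize (suc m) X 1+m≤∣X∣
... | Y , Y⊆X , ∣Y∣≡m = outside ∷ Y , out⊆ Y⊆X , ∣Y∣≡m
⊆-ofSize (suc m) (inside ∷ X) (s≤s m≤∣X∣) with ⊆-ofSize m X m≤∣X∣
... | Y , Y⊆X , ∣Y∣≡m = inside ∷ Y , in⊆in Y⊆X , cong suc ∣Y∣≡m

injective⇒≤∣∣ : ∀ {m n} (f : Fin m → Fin n) → Injective _≡_ _≡_ f →
                ∀ {X} → (∀ j → f j ∈ X) → m ≤ ∣ X ∣
injective⇒≤∣∣ {zero}  f f-inj f∈X = z≤n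
injective⇒≤∣∣ {suc m} f f-inj {X} f∈X =
  <-≤-trans (s≤s (injective⇒≤∣∣ (f ∘ suc) (suc-injective ∘ f-inj) f∘suc∈X-f0))
            (x∈p⇒∣p-x∣<∣p∣ (f∈X zero))
  where
  f∘suc∈X-f0 : ∀ j → f (suc j) ∈ X - f zero
  f∘suc∈X-f0 j = x∈p∧x≢y⇒x∈p-y (f∈X (suc j)) (0≢1+n ∘ sym ∘ f-inj)

image : ∀ {m n} → (Fin m → Fin n) → Subset n
image {zero}  f = ⊥
image {suc m} f = ⁅ f zero ⁆ ∪ image (f ∘ suc)

f∈image : ∀ {m n} (f : Fin m → Fin n) j → f j ∈ image f
f∈image f zero    = p⊆p∪q (image (f ∘ suc)) (x∈⁅x⁆ (f zero))
f∈image f (suc j) = q⊆p∪q ⁅ f zero ⁆ _ (f∈image (f ∘ suc) j)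

∈image⇒∃ : ∀ {m n} (f : Fin m → Fin n) {v} → v ∈ image f → ∃ λ j → f j ≡ v
∈image⇒∃ {zero}  f v∈⊥ = ⊥-elim (∉⊥ v∈⊥)
∈image⇒∃ {suc m} f {v} v∈ with x∈p∪q⁻ ⁅ f zero ⁆ (image (f ∘ suc)) v∈
... | inj₁ v∈⁅f0⁆ = zero , sym (x∈⁅y⁆⇒x≡y (f zero) v∈⁅f0⁆)
... | inj₂ v∈rest with ∈image⇒∃ (f ∘ suc) v∈rest
...   | j , fj≡v = suc j , fj≡v

avoid-two : ∀ {k} → 2 ≤ k → (a b : Fin (suc k)) → ∃ λ i → i ≢ a × i ≢ b
avoid-two (s≤s (s≤s _)) zero          zero          = suc zero       , (λ ()) , (λ ())
avoid-two (s≤s (s≤s _)) zero          (suc zero)    = suc (suc zero) , (λ ()) , (λ ())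
avoid-two (s≤s (s≤s _)) zero          (suc (suc b)) = suc zero       , (λ ()) , (λ ())
avoid-two (s≤s (s≤s _)) (suc zero)    zero          = suc (suc zero) , (λ ()) , (λ ())
avoid-two (s≤s (s≤s _)) (suc zero)    (suc b)       = zero           , (λ ()) , (λ ())
avoid-two (s≤s (s≤s _)) (suc (suc a)) zero          = suc zero       , (λ ()) , (λ ())
avoid-two (s≤s (s≤s _)) (suc (suc a)) (suc b)       = zero           , (λ ()) , (λ ())

clique-⊆ : ∀ {n} (G : Graph n) {S T : Subset n} → S ⊆ T → IsClique G T → IsClique G S
clique-⊆ G S⊆T T-clique i j i∈S j∈S = T-clique i j (S⊆T i∈S) (S⊆T j∈S)

clique⇒⊆maximalClique : ∀ {n} (G : Graph n) {T : Subset n} → IsClique G T →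
                        ∃ λ M → IsMaximalClique G M × T ⊆ M
clique⇒⊆maximalClique {n} G {T} = grow n (m≤m+n n ∣ T ∣)
  where
  grow : ∀ fuel {T} → n ≤ fuel + ∣ T ∣ → IsClique G T → ∃ λ M → IsMaximalClique G M × T ⊆ M
  grow fuel {T} n≤ T-clique with anySubset? (λ U → (T ⊂? U) ×-dec isClique? G U)
  ... | no ∄U = T , (T-clique , λ U U-clique T⊂U → ∄U (U , T⊂U , U-clique)) , λ x∈T → x∈T
  grow zero        n≤ _ | yes (U , T⊂U , _) =
    contradiction (≤-trans (∣p∣≤n U) n≤) (<⇒≱ (p⊂q⇒∣p∣<∣q∣ T⊂U))
  grow (suc fuel) {T} n≤ _ | yes (U , T⊂U , U-clique)
    with grow fuel (≤-trans n≤ (≤-trans (≤-reflexive (sym (+-suc fuel ∣ T ∣)))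
                                        (+-monoʳ-≤ fuel (p⊂q⇒∣p∣<∣q∣ T⊂U)))) U-clique
  ... | M , M-max , U⊆M = M , M-max , U⊆M ∘ proj₁ T⊂U

module UniqueMaximalClique {n} (G : Graph n) (k r : ℕ)
  (maxClique : ∀ S → IsKrSet G k S →
    Σ (Subset n) λ M → (IsMaximalClique G M × S ⊆ M × ∣ M ∣ ≤ r)
      × (∀ M' → IsMaximalClique G M' → S ⊆ M' → M' ≡ M))
  where

  M⟨_⟩ : ∀ {S} → IsKrSet G k S → Subset n
  M⟨ S-Kk ⟩ = proj₁ (maxClique _ S-Kk)

  clique-⊇Kk⇒⊆M : ∀ {S A} (S-Kk : IsKrSet G k S) → IsClique G A → S ⊆ A → A ⊆ M⟨ S-Kk ⟩
  clique-⊇Kk⇒⊆M {S} S-Kk A-clique S⊆A x∈A with clique⇒⊆maximalClique G A-clique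
  ... | M , M-max , A⊆M with proj₂ (proj₂ (maxClique S S-Kk)) M M-max (A⊆M ∘ S⊆A)
  ...   | refl = A⊆M x∈A

  Kr-⊇Kk⇒≡M : ∀ {S A} (S-Kk : IsKrSet G k S) → IsKrSet G r A → S ⊆ A → A ≡ M⟨ S-Kk ⟩
  Kr-⊇Kk⇒≡M {S} S-Kk (A-clique , ∣A∣≡r) S⊆A =
    p⊆q∧∣q∣≤∣p∣⇒p≡q (clique-⊇Kk⇒⊆M S-Kk A-clique S⊆A)
                     (≤-trans ∣M∣≤r (≤-reflexive (sym ∣A∣≡r)))
    where
    ∣M∣≤r : ∣ M⟨ S-Kk ⟩ ∣ ≤ r
    ∣M∣≤r = proj₂ (proj₂ (proj₁ (proj₂ (maxClique S S-Kk))))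

  Kr-∩-< : ∀ {A B} → IsKrSet G r A → IsKrSet G r B → A ≢ B → ∣ A ∩ B ∣ < k
  Kr-∩-< {A} {B} A-Kr B-Kr A≢B with ∣ A ∩ B ∣ <? k
  ... | yes ∣A∩B∣<k = ∣A∩B∣<k
  ... | no  ∣A∩B∣≮k with ⊆-ofSize k (A ∩ B) (≮⇒≥ ∣A∩B∣≮k)
  ...   | S , S⊆A∩B , ∣S∣≡k =
    contradiction (trans (Kr-⊇Kk⇒≡M S-Kk A-Kr S⊆A) (sym (Kr-⊇Kk⇒≡M S-Kk B-Kr S⊆B))) A≢B
    where
    S⊆A : S ⊆ A
    S⊆A = p∩q⊆p A B ∘ S⊆A∩B
    S⊆B : S ⊆ B
    S⊆B = p∩q⊆q A B ∘ S⊆A∩B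
    S-Kk : IsKrSet G k S
    S-Kk = clique-⊆ G S⊆A (proj₁ A-Kr) , ∣S∣≡k

  no-expansion : 2 ≤ k → ¬ HasExpansionCopy G r k
  no-expansion 2≤k (φ , φ-inj , edge) =
    core₀∉S₀ (core₀∈S₀ (⊆-ofSize k (image (core ∘ suc))
                          (injective⇒≤∣∣ (core ∘ suc) (suc-injective ∘ core-inj) (f∈image (core ∘ suc)))))
    where
    core : Fin (suc k) → Fin n
    core = φ ∘ inj₁

    core-inj : Injective _≡_ _≡_ core
    core-inj eq with φ-inj eq
    ... | refl = refl

    S : Fin (suc k) → Subset n
    S i = proj₁ (edge i)

    S-Kr : ∀ i → IsKrSet G r (S i)
    S-Kr i = proj₁ (proj₂ (edge i))

    core∈S : ∀ {i j} → j ≢ i → core j ∈ S i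
    core∈S {i} {j} j≢i = proj₂ (proj₂ (proj₂ (edge i)) (core j)) (inj₁ j) j≢i

    core₀∉S₀ : core zero ∉ S zero
    core₀∉S₀ core₀∈S₀ with proj₁ (proj₂ (proj₂ (edge zero)) (core zero)) core₀∈S₀
    ... | x , x∈edge₀ , φx≡core₀ with φ-inj φx≡core₀
    ...   | refl = x∈edge₀ refl

    cores-clique : IsClique G (image core)
    cores-clique x y x∈ y∈ x≢y with ∈image⇒∃ core x∈ | ∈image⇒∃ core y∈
    ... | a , refl | b , refl with avoid-two 2≤k a b
    ...   | i , i≢a , i≢b =
      proj₁ (S-Kr i) (core a) (core b) (core∈S (i≢a ∘ sym)) (core∈S (i≢b ∘ sym)) x≢y

    other-cores⊆S₀ : image (core ∘ suc) ⊆ S zero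
    other-cores⊆S₀ v∈ with ∈image⇒∃ (core ∘ suc) v∈
    ... | j , refl = core∈S (λ ())

    core₀∈S₀ : (∃ λ Y → Y ⊆ image (core ∘ suc) × ∣ Y ∣ ≡ k) → core zero ∈ S zero
    core₀∈S₀ (Y , Y⊆other-cores , ∣Y∣≡k) =
      subst (core zero ∈_) (sym (Kr-⊇Kk⇒≡M Y-Kk (S-Kr zero) (other-cores⊆S₀ ∘ Y⊆other-cores)))
            (clique-⊇Kk⇒⊆M Y-Kk cores-clique Y⊆cores (f∈image core zero))
      where
      Y⊆cores : Y ⊆ image core
      Y⊆cores = q⊆p∪q ⁅ core zero ⁆ _ ∘ Y⊆other-cores
      Y-Kk : IsKrSet G k Y
      Y-Kk = clique-⊆ G Y⊆cores cores-clique , ∣Y∣≡k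

proposition3p2 :
    (r k : ℕ) → 2 ≤ k → k < r →
    (G : (n : ℕ) → Graph n) →
    AtLeastPolyExpSqrtLog k (λ n → #Kr (G n) r) →
    (∀ n (S : Subset n) → IsKrSet (G n) k S →
        Σ (Subset n) λ M → (IsMaximalClique (G n) M × S ⊆ M × ∣ M ∣ ≤ r)
          × (∀ M' → IsMaximalClique (G n) M' → S ⊆ M' → M' ≡ M)) →
    AtLeastPolyExpSqrtLog k (λ n → eH (G n) r)
    × (∀ n (A B : Subset n) → IsEdgeH (G n) r A → IsEdgeH (G n) r B → A ≢ B →
        ∣ A ∩ B ∣ ≤ k ∸ 1)
    × (∀ n → ¬ HasExpansionCopy (G n) r k)
proposition3p2 r k@(suc _) 2≤k _ G #Kr-growth maxClique =
  #Kr-growth ,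
  (λ n _ _ A-Kr B-Kr A≢B → ≤-pred (U.Kr-∩-< n A-Kr B-Kr A≢B)) ,
  (λ n → U.no-expansion n 2≤k)
  where
  module U n = UniqueMaximalClique (G n) k r (maxClique n)
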